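{- Let $q$ be a prime power, let $\Delta\ge 1$ and $1\le a\le b$ be integers, and let $G=(I_k\,|\,R)\in\mathbb{F}_q^{k\times n}$ be a systematic generator matrix of a linear $[n,k]_q$ code $C$ of effective length $n$ whose non-zero codewords all have weights in $\{i\Delta : a\le i\le b\}$. For every point $P$ of $\operatorname{PG}(k-1,\mathbb{F}_q)$ let $c(P)$ be the number of columns of $G$ whose span equals $P$, and let $r\ge 1$ be an integer. Let $\mathcal{S}(G)$ be the set of all vectors $(x,y)$, with $x=(x_Q)_{Q\in\mathcal{P}_{k+1}}$ and $y=(y_H)_{H\in\mathcal{H}_{k+1}}$, satisfying \begin{itemize} \item $\Delta y_H+\sum_{Q\in\mathcal{P}_{k+1},\,Q\le H} x_Q = n+r-a\Delta$ for all $H\in\mathcal{H}_{k+1}$; \item for every point $\langle u\rangle\in\mathcal{P}_k$: $\sum_{\alpha\in\mathbb{F}_q} x_{\langle (u|\alpha)\rangle}=c(\langle u\rangle)$, and $x_{\langle e_{k+1}\rangle}=r$ (this is the case $u=\mathbf{0}$, where $c(\mathbf{0}):=r$); \item $x_{\langle e_i\rangle}\ge 1$ for all $1\le i\le k+1$, where $e_i$ is the $i$-th unit vector of $\mathbb{F}_q^{k+1}$; \item $x_Q\in\mathbb{N}$ for all $Q\in\mathcal{P}_{k+1}$; \item $y_H\in\{0,1,\dots,b-a\}$ for all $H\in\mathcal{H}_{k+1}$. \end{itemize} Then for every systematic generator matrix $G'\in\mathbb{F}_q^{(k+1)\times(n+r)}$ of a linear $[n+r,k+1]_q$ code $C'$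 such that the submatrix of the first $k$ rows of $G'$ coincides with $G$ up to $r$ additionally inserted all-zero columns, and such that all non-zero codewords of $C'$ have weights in $\{i\Delta : a\le i\le b\}$, there is a solution $(x,y)\in\mathcal{S}(G)$ such that, for each $Q\in\mathcal{P}_{k+1}$, $G'$ has exactly $x_Q$ columns whose span equals $Q$.
   Context: An $[n,k]_q$ code is a $k$-dimensional subspace of $\mathbb{F}_q^n$; throughout, the length of a code equals its effective length (every coordinate is non-zero in some codeword). A systematic generator matrix of an $[n,k]_q$ code is a generator matrix of the form $(I_k\,|\,R)$ with $I_k$ the $k\times k$ identity. $\mathcal{P}_k$ denotes the set of points ($1$-dimensional subspaces of $\mathbb{F}_q^k$) of $\operatorname{PG}(k-1,\mathbb{F}_q)$ and $\mathcal{H}_k$ the set of hyperplanes ($(k-1)$-dimensional subspaces of $\mathbb{F}_q^k$); $Q\le H$ means the point $Q$ is contained in $H$. For a column vector $v\neq 0$, $\langle v\rangle$ denotes its span; $(u|\alpha)\in\mathbb{F}_q^{k+1}$ denotes $u\in\mathbb{F}_q^k$ with the entry $\alpha$ appended. The Hamming weight of a vector is its number of non-zero entries. -}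

module Defs where

open import Data.Nat as ℕ using (ℕ; zero; suc; _≤_)
open import Data.Fin as Fin using (Fin; inject≤; _<_)
open import Data.List as List using (List; []; _∷_; allFin; filter; length; concatMap)
open import Data.Nat.ListAction using (sum)
open import Data.Empty using (⊥-elim)
open import Data.List.Membership.Propositional using (_∈_; lose)
open import Data.List.Relation.Unary.Any using (Any; any?; satisfied)
open import Data.List.Relation.Unary.Unique.Propositional using (Unique)
open import Data.Vec as Vec using (Vec; []; _∷_; _∷ʳ_; replicate; zipWith; tabulate)
import Data.Vec.Properties as VecP
open import Data.Product using (Σ; ∃; _×_; _,_; proj₁)
open import Relation.Nullary using (¬_; Dec; yes; no; ¬?; _×-dec_)
open import Relation.Nullary.Decidable using (map′)
open import Relation.Binary.PropositionalEquality using (_≡_; _≢_; refl)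
open import Relation.Binary.Definitions using (DecidableEquality)
open import Algebra.Structures using (IsCommutativeRing)

-- A finite field F_q, with propositional equality.  q = length elements.
-- (Every finite field has prime-power order, so "q a prime power" is automatic.)
record FiniteField : Set₁ where
  field
    Carrier  : Set
    _+_ _*_  : Carrier → Carrier → Carrier
    -_       : Carrier → Carrier
    0# 1#    : Carrier
    isCommutativeRing : IsCommutativeRing _≡_ _+_ _*_ -_ 0# 1#
    0≢1      : 0# ≢ 1#
    inverse  : ∀ x → x ≢ 0# → Σ Carrier (λ y → x * y ≡ 1#)
    _≟_      : DecidableEquality Carrier
    elements : List Carrier
    complete : ∀ x → x ∈ elements
    unique   : Unique elements

module FF (F : FiniteField) where
  open FiniteField F public

  Mat : ℕ → ℕ → Set
  Mat k n = Fin k → Fin n → Carrier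

  Vector : ℕ → Set
  Vector n = Vec Carrier n

  allVecs : (n : ℕ) → List (Vector n)
  allVecs zero    = [] ∷ []
  allVecs (suc n) = concatMap (λ α → List.map (α ∷_) (allVecs n)) elements

  dot : ∀ {n} → Vector n → Vector n → Carrier
  dot u v = Vec.foldr _ _+_ 0# (zipWith _*_ u v)

  scale : ∀ {n} → Carrier → Vector n → Vector n
  scale α v = Vec.map (α *_) v

  zeroVec : ∀ {n} → Vector n
  zeroVec = replicate _ 0#

  unit : ∀ {n} → Fin n → Vector n
  unit Fin.zero    = 1# ∷ zeroVec
  unit (Fin.suc i) = 0# ∷ unit i

  data Normalized : ∀ {n} → Vector n → Set where
    here  : ∀ {n} {v : Vector n} → Normalized (1# ∷ v)
    there : ∀ {n} {v : Vector n} → Normalized v → Normalized (0# ∷ v)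

  normalized? : ∀ {n} (v : Vector n) → Dec (Normalized v)
  normalized? [] = no λ ()
  normalized? (x ∷ v) with x ≟ 1#
  ... | yes refl = yes here
  ... | no x≢1 with x ≟ 0#
  ...   | yes refl = map′ there (λ { (there p) → p ; here → ⊥-elim (0≢1 refl) }) (normalized? v)
  ...   | no x≢0 = no λ { here → x≢1 refl ; (there _) → x≢0 refl }

  -- points of PG(n-1, q): 1-dim subspaces of F^n, given by their normalized representative
  Point : ℕ → Set
  Point n = Σ (Vector n) Normalized

  -- hyperplanes of PG(n-1, q): (n-1)-dim subspaces of F^n, given by a normalized
  -- normal (dual) vector h; the hyperplane is { v | h · v = 0 }
  Hyperplane : ℕ → Set
  Hyperplane n = Σ (Vector n) Normalized

  _≤ₚ_ : ∀ {n} → Point n → Hyperplane n → Set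
  Q ≤ₚ H = dot (proj₁ H) (proj₁ Q) ≡ 0#

  _≤ₚ?_ : ∀ {n} (Q : Point n) (H : Hyperplane n) → Dec (Q ≤ₚ H)
  Q ≤ₚ? H = dot (proj₁ H) (proj₁ Q) ≟ 0#

  allPoints : (n : ℕ) → List (Point n)
  allPoints n = concatMap f (allVecs n)
    where
    f : Vector n → List (Point n)
    f v with normalized? v
    ... | yes p = (v , p) ∷ []
    ... | no  _ = []

  allHyperplanes : (n : ℕ) → List (Hyperplane n)
  allHyperplanes = allPoints

  SpanEq : ∀ {n} → Vector n → Point n → Set
  SpanEq v P = ∃ λ α → α ≢ 0# × v ≡ scale α (proj₁ P)

  spanEq? : ∀ {n} (v : Vector n) (P : Point n) → Dec (SpanEq v P)
  spanEq? v P = map′ satisfied (λ { (α , h) → lose (complete α) h })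
                  (any? (λ α → ¬? (α ≟ 0#) ×-dec VecP.≡-dec _≟_ v (scale α (proj₁ P))) elements)

  column : ∀ {k n} → Mat k n → Fin n → Vector k
  column G j = tabulate (λ i → G i j)

  colCount : ∀ {k n} → Mat k n → Point k → ℕ
  colCount {n = n} G P = length (filter (λ j → spanEq? (column G j) P) (allFin n))

  codeword : ∀ {k n} → Mat k n → Vector k → Fin n → Carrier
  codeword G m j = dot m (column G j)

  IsZeroWord : ∀ {n} → (Fin n → Carrier) → Set
  IsZeroWord c = ∀ j → c j ≡ 0#

  weight : ∀ {n} → (Fin n → Carrier) → ℕ
  weight {n} c = length (filter (λ j → ¬? (c j ≟ 0#)) (allFin n))

  IsSystematic : ∀ {k n} → Mat k n → Set
  IsSystematic {k} {n} G =
    Σ (k ≤ n) λ k≤n → ∀ i j → G i (inject≤ j k≤n) ≡ Vec.lookup (unit i) j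

  FullEffectiveLength : ∀ {k n} → Mat k n → Set
  FullEffectiveLength {k} {n} G = ∀ j → ∃ λ (m : Vector k) → codeword G m j ≢ 0#

  WeightsIn : ∀ {k n} → Mat k n → (Δ a b : ℕ) → Set
  WeightsIn {k} G Δ a b = ∀ (m : Vector k) → ¬ IsZeroWord (codeword G m) →
    ∃ λ i → a ≤ i × i ≤ b × weight (codeword G m) ≡ i ℕ.* Δ

  ExtendsWithZeroCols : ∀ {k n} (r : ℕ) → Mat (suc k) (n ℕ.+ r) → Mat k n → Set
  ExtendsWithZeroCols {k} {n} r G' G =
    Σ (Fin n → Fin (n ℕ.+ r)) λ ι →
      (∀ j j' → j < j' → ι j < ι j')
      × (∀ i j → G' (Fin.inject₁ i) (ι j) ≡ G i j)
      × (∀ j' → (∀ j → ι j ≢ j') → ∀ i → G' (Fin.inject₁ i) j' ≡ 0#)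

  extN : ∀ {m} {u : Vector m} (α : Carrier) → Normalized u → Normalized (u ∷ʳ α)
  extN α here = here
  extN α (there p) = there (extN α p)

  ext : ∀ {k} → Point k → Carrier → Point (suc k)
  ext (u , p) α = (u ∷ʳ α) , extN α p

  unitN : ∀ {m} (i : Fin m) → Normalized (unit i)
  unitN Fin.zero    = here
  unitN (Fin.suc i) = there (unitN i)

  unitPoint : ∀ {m} → Fin m → Point m
  unitPoint i = unit i , unitN i

  InS : ∀ {k n} → Mat k n → (Δ a b r : ℕ) →
        (Point (suc k) → ℕ) → (Hyperplane (suc k) → ℕ) → Set
  InS {k} {n} G Δ a b r x y =
      (∀ H → Δ ℕ.* y H ℕ.+ sum (List.map x (filter (λ Q → Q ≤ₚ? H) (allPoints (suc k))))
               ℕ.+ a ℕ.* Δ ≡ n ℕ.+ r)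
    × (∀ (u : Point k) →
         sum (List.map (λ α → x (ext u α)) elements) ≡ colCount G u)
    × x (unitPoint (Fin.fromℕ k)) ≡ r
    × (∀ i → 1 ℕ.≤ x (unitPoint i))
    × (∀ H → y H ≤ b ℕ.∸ a)

module Submission where

-- The solution is x_Q := number of columns of G' spanning Q, and y_H := i_H − a, where i_H Δ is
-- the weight of the codeword hG' attached to the hyperplane H = h^⊥ (non-zero, as G' is
-- systematic).  Every constraint of S(G) is then a counting identity about the columns of G':
--  * the hyperplane equations: by double counting, Σ_{Q ≤ H} x_Q is the number of zero
--    coordinates of hG', namely n + r − i_H Δ;
--  * the fibre equations: a column (t|l) spans exactly one point ⟨(u|α)⟩ if t spans ⟨u⟩ and none
--    otherwise, so Σ_α x_⟨(u|α)⟩ counts the columns of G' whose top part t spans ⟨u⟩; these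
--    correspond to the columns of G spanning ⟨u⟩, since the inserted columns have t = 0;
--  * x_⟨e_{k+1}⟩ = r: the columns spanning ⟨e_{k+1}⟩ are exactly the r inserted ones;
--  * x_⟨e_i⟩ ≥ 1 because G' contains the identity matrix, and y_H ≤ b − a because i_H ≤ b.

open import Defs
open import Data.Nat as ℕ using (ℕ; zero; suc; _≤_; _∸_)
import Data.Nat.Properties as ℕP
open import Data.Nat.ListAction using (sum)
open import Data.Fin as Fin using (Fin; inject≤)
import Data.Fin.Properties as FinP
open import Data.List as List using (List; []; _∷_; filter; length; allFin; concatMap; _++_; cartesianProductWith)
import Data.List.Properties as ListP
open import Data.List.Membership.Propositional using (_∈_; lose)
import Data.List.Membership.Propositional.Properties as ∈P
open import Data.List.Relation.Unary.Any as Any using (here; there)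
import Data.List.Relation.Unary.All as All
open import Data.List.Relation.Unary.AllPairs using ([]; _∷_)
open import Data.List.Relation.Unary.Unique.Propositional using (Unique)
import Data.List.Relation.Unary.Unique.Propositional.Properties as UniqueP
open import Data.Vec as Vec using (Vec; []; _∷_; _∷ʳ_; replicate; tabulate)
import Data.Vec.Properties as VecP
open import Data.Product using (Σ; ∃; _×_; _,_; proj₁; proj₂)
open import Data.Empty using (⊥-elim)
open import Function using (id)
open import Relation.Nullary using (¬_; Dec; yes; no; ¬?; _×-dec_)
open import Relation.Nullary.Decidable using (decidable-stable)
open import Relation.Binary.Definitions using (tri<; tri≈; tri>)
open import Relation.Binary.PropositionalEquality
  using (_≡_; _≢_; refl; sym; trans; cong; cong₂; subst; module ≡-Reasoning)

module Counting where

  open import Data.Nat using (_+_)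
  open import Algebra.Properties.CommutativeSemigroup ℕP.+-commutativeSemigroup using (interchange)

  indicator : {P : Set} → Dec P → ℕ
  indicator (yes _) = 1
  indicator (no _)  = 0

  count : {A : Set} {P : A → Set} → (∀ a → Dec (P a)) → List A → ℕ
  count P? xs = length (filter P? xs)

  private
    variable
      A B : Set

  count-∷ : {P : A → Set} (P? : ∀ a → Dec (P a)) (x : A) (xs : List A) →
            count P? (x ∷ xs) ≡ indicator (P? x) + count P? xs
  count-∷ P? x xs with P? x
  ... | yes _ = refl
  ... | no _  = refl

  sum-map-cong : {f g : A → ℕ} → (∀ a → f a ≡ g a) → (L : List A) →
                 sum (List.map f L) ≡ sum (List.map g L)
  sum-map-cong f≗g L = cong sum (ListP.map-cong f≗g L)

  sum-map-+ : (f g : A → ℕ) (L : List A) →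
              sum (List.map (λ a → f a + g a) L) ≡ sum (List.map f L) + sum (List.map g L)
  sum-map-+ f g []      = refl
  sum-map-+ f g (x ∷ L) =
    trans (cong (f x + g x +_) (sum-map-+ f g L)) (interchange (f x) (g x) _ _)

  sum-ones : (L : List A) → sum (List.map (λ _ → 1) L) ≡ length L
  sum-ones []      = refl
  sum-ones (_ ∷ L) = cong suc (sum-ones L)

  sum-indicator : {P : A → Set} (P? : ∀ a → Dec (P a)) (L : List A) →
                  sum (List.map (λ a → indicator (P? a)) L) ≡ count P? L
  sum-indicator P? []      = refl
  sum-indicator P? (x ∷ L) = trans (cong (indicator (P? x) +_) (sum-indicator P? L)) (sym (count-∷ P? x L))

  count-fubini : {R : A → B → Set} (R? : ∀ a b → Dec (R a b)) (L : List A) (M : List B) →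
                 sum (List.map (λ a → count (R? a) M) L) ≡ sum (List.map (λ b → count (λ a → R? a b) L) M)
  count-fubini R? L [] = trans (sum-map-cong (λ _ → refl) L) (sum-zero L)
    where
    sum-zero : (L : List A) → sum (List.map (λ _ → 0) L) ≡ 0
    sum-zero []      = refl
    sum-zero (_ ∷ L) = sum-zero L
  count-fubini R? L (b ∷ M) = begin
    sum (List.map (λ a → count (R? a) (b ∷ M)) L)
      ≡⟨ sum-map-cong (λ a → count-∷ (R? a) b M) L ⟩
    sum (List.map (λ a → indicator (R? a b) + count (R? a) M) L)
      ≡⟨ sum-map-+ _ _ L ⟩
    sum (List.map (λ a → indicator (R? a b)) L) + sum (List.map (λ a → count (R? a) M) L)
      ≡⟨ cong₂ _+_ (sum-indicator (λ a → R? a b) L) (count-fubini R? L M) ⟩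
    count (λ a → R? a b) L + sum (List.map (λ b → count (λ a → R? a b) L) M) ∎
    where open ≡-Reasoning

  double-count : {R : A → B → Set} (R? : ∀ a b → Dec (R a b))
                 {Q : B → Set} (Q? : ∀ b → Dec (Q b)) (L : List A) (M : List B) →
                 (∀ b → count (λ a → R? a b) L ≡ indicator (Q? b)) →
                 sum (List.map (λ a → count (R? a) M) L) ≡ count Q? M
  double-count R? Q? L M column =
    trans (count-fubini R? L M) (trans (sum-map-cong column M) (sum-indicator Q? M))

  count-zero : {P : A → Set} (P? : ∀ a → Dec (P a)) (L : List A) →
               (∀ a → a ∈ L → ¬ P a) → count P? L ≡ 0
  count-zero P? L none = cong length (ListP.filter-none P? (All.tabulate (λ {a} a∈L → none a a∈L)))

  count-one : {K : Set} {P : A → Set} (P? : ∀ a → Dec (P a)) (key : A → K) (L : List A) →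
              Unique (List.map key L) → (∀ {a a'} → P a → P a' → key a ≡ key a') →
              ∀ {a} → a ∈ L → P a → count P? L ≡ 1
  count-one P? key (x ∷ L) (x∉L ∷ unique) sameKey {a} a∈ Pa with P? x
  ... | yes Px = cong suc (count-zero P? L (λ a' a'∈L Pa' →
                   All.lookup x∉L (∈P.∈-map⁺ key a'∈L) (sameKey Px Pa')))
  ... | no ¬Px with a∈
  ...   | here refl = ⊥-elim (¬Px Pa)
  ...   | there a∈L = count-one P? key L unique sameKey a∈L Pa

  count-pos : {P : A → Set} (P? : ∀ a → Dec (P a)) (L : List A) → ∀ {a} → a ∈ L → P a → 1 ≤ count P? L
  count-pos P? L a∈L Pa = ListP.filter-some P? (Any.map (λ { refl → Pa }) a∈L)

  count-cong : {P Q : A → Set} (P? : ∀ a → Dec (P a)) (Q? : ∀ a → Dec (Q a)) →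
               (∀ a → P a → Q a) → (∀ a → Q a → P a) → (L : List A) → count P? L ≡ count Q? L
  count-cong P? Q? P⇒Q Q⇒P L = cong length (ListP.filter-≐ P? Q? ((λ {a} → P⇒Q a) , (λ {a} → Q⇒P a)) L)

  count-filter : {P S : A → Set} (P? : ∀ a → Dec (P a)) (S? : ∀ a → Dec (S a)) (L : List A) →
                 count P? (filter S? L) ≡ count (λ a → P? a ×-dec S? a) L
  count-filter P? S? [] = refl
  count-filter P? S? (x ∷ L) with S? x
  ... | yes _ with P? x
  ...   | yes _ = cong suc (count-filter P? S? L)
  ...   | no _  = count-filter P? S? L
  count-filter P? S? (x ∷ L) | no _ with P? x
  ...   | yes _ = count-filter P? S? L
  ...   | no _  = count-filter P? S? L

  count-complement : {P : A → Set} (P? : ∀ a → Dec (P a)) (L : List A) →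
                     count P? L + count (λ a → ¬? (P? a)) L ≡ length L
  count-complement P? [] = refl
  count-complement P? (x ∷ L) with P? x
  ... | yes _ = cong suc (count-complement P? L)
  ... | no _  = trans (ℕP.+-suc (count P? L) _) (cong suc (count-complement P? L))

  count-all : {P : A → Set} (P? : ∀ a → Dec (P a)) (L : List A) → (∀ a → P a) → count P? L ≡ length L
  count-all P? L always = cong length (ListP.filter-all P? {L} (All.tabulate (λ {a} _ → always a)))

  concatMap-rows : {C : Set} (f : A → B → C) (xs : List A) (ys : List B) →
                   concatMap (λ x → List.map (f x) ys) xs ≡ cartesianProductWith f xs ys
  concatMap-rows f []       ys = refl
  concatMap-rows f (x ∷ xs) ys = cong (List.map (f x) ys ++_) (concatMap-rows f xs ys)

  strictlyMonotone⇒injective : ∀ {m N} (ι : Fin m → Fin N) → (∀ j j' → j Fin.< j' → ι j Fin.< ι j') →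
                               ∀ {j j'} → ι j ≡ ι j' → j ≡ j'
  strictlyMonotone⇒injective ι mono {j} {j'} ιj≡ιj' with FinP.<-cmp j j'
  ... | tri< j<j' _ _ = ⊥-elim (FinP.<-irrefl ιj≡ιj' (mono j j' j<j'))
  ... | tri≈ _ j≡j' _ = j≡j'
  ... | tri> _ _ j'<j = ⊥-elim (FinP.<-irrefl (sym ιj≡ιj') (mono j' j j'<j))

  allFin-unique : ∀ N → Unique (List.map id (allFin N))
  allFin-unique N = subst Unique (sym (ListP.map-id (allFin N))) (UniqueP.allFin⁺ N)

  count-along-injection : ∀ {m N} (ι : Fin m → Fin N) → (∀ {j j'} → ι j ≡ ι j' → j ≡ j') →
                          {Q : Fin N → Set} (Q? : ∀ j' → Dec (Q j')) → (∀ j' → Q j' → ∃ λ j → ι j ≡ j') →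
                          count Q? (allFin N) ≡ count (λ j → Q? (ι j)) (allFin m)
  count-along-injection {m} {N} ι injective {Q} Q? onImage = begin
    count Q? (allFin N)
      ≡⟨ sym (double-count R? Q? L (allFin N) (λ j' → trans (count-filter (λ j → R? j j') _ (allFin m)) (preimages j' (Q? j')))) ⟩
    sum (List.map (λ j → count (R? j) (allFin N)) L)
      ≡⟨ sum-map-cong (λ j → count-one (R? j) id (allFin N) (allFin-unique N) (λ e e' → trans (sym e) e') (∈P.∈-allFin (ι j)) refl) L ⟩
    sum (List.map (λ _ → 1) L)
      ≡⟨ sum-ones L ⟩
    count (λ j → Q? (ι j)) (allFin m) ∎
    where
    open ≡-Reasoning
    L : List (Fin m)
    L = filter (λ j → Q? (ι j)) (allFin m)
    R? : ∀ j j' → Dec (ι j ≡ j')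
    R? j j' = ι j Fin.≟ j'
    -- an element of the image has exactly one preimage, and only elements satisfying Q are counted
    preimages : ∀ j' (d : Dec (Q j')) → count (λ j → R? j j' ×-dec Q? (ι j)) (allFin m) ≡ indicator d
    preimages j' (yes Qj') =
      let (j , ιj≡j') = onImage j' Qj'
      in count-one _ id (allFin m) (allFin-unique m) (λ (e , _) (e' , _) → injective (trans e (sym e')))
           (∈P.∈-allFin j) (ιj≡j' , subst Q (sym ιj≡j') Qj')
    preimages j' (no ¬Qj') = count-zero _ (allFin m) (λ j _ (ιj≡j' , Qιj) → ¬Qj' (subst Q ιj≡j' Qιj))


module Projective (F : FiniteField) where

  open import Algebra.Structures using (IsCommutativeRing)
  open Counting using (concatMap-rows)
  open FF F
  open IsCommutativeRing isCommutativeRing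
    using (*-assoc; *-comm; *-identityˡ; *-identityʳ; zeroʳ; +-identityˡ; +-identityʳ; distribˡ)
  open ≡-Reasoning

  infix 30 _⁻¹
  _⁻¹ : ∀ {x} → x ≢ 0# → Carrier
  x≢0 ⁻¹ = proj₁ (inverse _ x≢0)

  inverseʳ : ∀ {x} (x≢0 : x ≢ 0#) → x * x≢0 ⁻¹ ≡ 1#
  inverseʳ {x} x≢0 = proj₂ (inverse x x≢0)

  inverseˡ : ∀ {x} (x≢0 : x ≢ 0#) → x≢0 ⁻¹ * x ≡ 1#
  inverseˡ {x} x≢0 = trans (*-comm _ x) (inverseʳ x≢0)

  *-cancelˡ : ∀ {x a b} → x ≢ 0# → x * a ≡ x * b → a ≡ b
  *-cancelˡ {x} {a} {b} x≢0 xa≡xb = begin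
    a                   ≡⟨ sym (*-identityˡ a) ⟩
    1# * a              ≡⟨ cong (_* a) (sym (inverseˡ x≢0)) ⟩
    (x≢0 ⁻¹ * x) * a    ≡⟨ *-assoc _ x a ⟩
    x≢0 ⁻¹ * (x * a)    ≡⟨ cong (x≢0 ⁻¹ *_) xa≡xb ⟩
    x≢0 ⁻¹ * (x * b)    ≡⟨ sym (*-assoc _ x b) ⟩
    (x≢0 ⁻¹ * x) * b    ≡⟨ cong (_* b) (inverseˡ x≢0) ⟩
    1# * b              ≡⟨ *-identityˡ b ⟩
    b                   ∎

  *-zero-cancelˡ : ∀ {x a} → x ≢ 0# → x * a ≡ 0# → a ≡ 0#
  *-zero-cancelˡ {x} x≢0 xa≡0 = *-cancelˡ x≢0 (trans xa≡0 (sym (zeroʳ x)))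

  1≢0 : 1# ≢ 0#
  1≢0 1≡0 = 0≢1 (sym 1≡0)

  dot-zeroʳ : ∀ {m} (h : Vector m) → dot h zeroVec ≡ 0#
  dot-zeroʳ []      = refl
  dot-zeroʳ (x ∷ h) = trans (cong₂ _+_ (zeroʳ x) (dot-zeroʳ h)) (+-identityˡ 0#)

  dot-scaleʳ : ∀ {m} (h v : Vector m) α → dot h (scale α v) ≡ α * dot h v
  dot-scaleʳ []      []      α = sym (zeroʳ α)
  dot-scaleʳ (x ∷ h) (y ∷ v) α =
    trans (cong₂ _+_ (x*αy≡α*xy x y) (dot-scaleʳ h v α)) (sym (distribˡ α (x * y) (dot h v)))
    where
    x*αy≡α*xy : ∀ x y → x * (α * y) ≡ α * (x * y)
    x*αy≡α*xy x y = trans (sym (*-assoc x α y)) (trans (cong (_* y) (*-comm x α)) (*-assoc α x y))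

  dot-unitʳ : ∀ {m} (h : Vector m) i → dot h (unit i) ≡ Vec.lookup h i
  dot-unitʳ (x ∷ h) Fin.zero    = trans (cong₂ _+_ (*-identityʳ x) (dot-zeroʳ h)) (+-identityʳ x)
  dot-unitʳ (x ∷ h) (Fin.suc i) = trans (cong₂ _+_ (zeroʳ x) (dot-unitʳ h i)) (+-identityˡ _)

  scale-scale : ∀ {m} α β (v : Vector m) → scale α (scale β v) ≡ scale (α * β) v
  scale-scale α β v = trans (sym (VecP.map-∘ (α *_) (β *_) v)) (VecP.map-cong (λ y → sym (*-assoc α β y)) v)

  scale-one : ∀ {m} (v : Vector m) → scale 1# v ≡ v
  scale-one v = trans (VecP.map-cong *-identityˡ v) (VecP.map-id v)

  scale-zeroVec : ∀ {m} α → scale α (zeroVec {m}) ≡ zeroVec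
  scale-zeroVec {m} α = trans (VecP.map-replicate (α *_) 0# m) (cong (replicate m) (zeroʳ α))

  scale-injective : ∀ {m α} {v w : Vector m} → α ≢ 0# → scale α v ≡ scale α w → v ≡ w
  scale-injective {α = α} {v} {w} α≢0 αv≡αw = begin
    v                                  ≡⟨ sym (undo v) ⟩
    scale (α≢0 ⁻¹) (scale α v)         ≡⟨ cong (scale (α≢0 ⁻¹)) αv≡αw ⟩
    scale (α≢0 ⁻¹) (scale α w)         ≡⟨ undo w ⟩
    w                                  ∎
    where
    undo : ∀ u → scale (α≢0 ⁻¹) (scale α u) ≡ u
    undo u = trans (scale-scale _ α u) (trans (cong (λ c → scale c u) (inverseˡ α≢0)) (scale-one u))

  normalized-nonzero : ∀ {m} {p : Vector m} → Normalized p → ∀ {α} → α ≢ 0# → scale α p ≢ zeroVec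
  normalized-nonzero here       {α} α≢0 αp≡0 = α≢0 (trans (sym (*-identityʳ α)) (VecP.∷-injectiveˡ αp≡0))
  normalized-nonzero (there np) α≢0 αp≡0     = normalized-nonzero np α≢0 (VecP.∷-injectiveʳ αp≡0)

  normalized-scalar : ∀ {m} {p : Vector m} → Normalized p → ∀ {α β} → scale α p ≡ scale β p → α ≡ β
  normalized-scalar here {α} {β} αp≡βp =
    trans (sym (*-identityʳ α)) (trans (VecP.∷-injectiveˡ αp≡βp) (*-identityʳ β))
  normalized-scalar (there np) αp≡βp = normalized-scalar np (VecP.∷-injectiveʳ αp≡βp)

  normalized-unique : ∀ {m} {p p' : Vector m} → Normalized p → Normalized p' → ∀ {α β} →
                      α ≢ 0# → β ≢ 0# → scale α p ≡ scale β p' → p ≡ p'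
  normalized-unique (here {v = v}) (here {v = v'}) {α} {β} α≢0 _ αp≡βp' =
    cong (1# ∷_) (scale-injective α≢0 (trans (VecP.∷-injectiveʳ αp≡βp') (cong (λ c → scale c v') (sym α≡β))))
    where
    α≡β : α ≡ β
    α≡β = trans (sym (*-identityʳ α)) (trans (VecP.∷-injectiveˡ αp≡βp') (*-identityʳ β))
  normalized-unique here (there _) {α} {β} α≢0 _ αp≡βp' =
    ⊥-elim (α≢0 (trans (sym (*-identityʳ α)) (trans (VecP.∷-injectiveˡ αp≡βp') (zeroʳ β))))
  normalized-unique (there _) here {α} {β} _ β≢0 αp≡βp' =
    ⊥-elim (β≢0 (trans (sym (*-identityʳ β)) (trans (sym (VecP.∷-injectiveˡ αp≡βp')) (zeroʳ α))))
  normalized-unique (there np) (there np') α≢0 β≢0 αp≡βp' =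
    cong (0# ∷_) (normalized-unique np np' α≢0 β≢0 (VecP.∷-injectiveʳ αp≡βp'))

  spanEq-unique : ∀ {m} {v : Vector m} (P P' : Point m) → SpanEq v P → SpanEq v P' → proj₁ P ≡ proj₁ P'
  spanEq-unique (p , np) (p' , np') (α , α≢0 , v≡αp) (β , β≢0 , v≡βp') =
    normalized-unique np np' α≢0 β≢0 (trans (sym v≡αp) v≡βp')

  normalize : ∀ {m} (v : Vector m) → v ≢ zeroVec →
              Σ (Vector m) λ p → Normalized p × Σ Carrier λ α → α ≢ 0# × v ≡ scale α p
  normalize []      v≢0 = ⊥-elim (v≢0 refl)
  normalize (x ∷ w) v≢0 with x ≟ 0#
  ... | yes refl =
    let (p , np , α , α≢0 , w≡αp) = normalize w (λ w≡0 → v≢0 (cong (0# ∷_) w≡0))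
    in 0# ∷ p , there np , α , α≢0 , cong₂ _∷_ (sym (zeroʳ α)) w≡αp
  ... | no x≢0 =
    1# ∷ scale (x≢0 ⁻¹) w , here , x , x≢0 , cong₂ _∷_ (sym (*-identityʳ x)) (sym x[x⁻¹w]≡w)
    where
    x[x⁻¹w]≡w : scale x (scale (x≢0 ⁻¹) w) ≡ w
    x[x⁻¹w]≡w = trans (scale-scale x _ w) (trans (cong (λ c → scale c w) (inverseʳ x≢0)) (scale-one w))

  allVecs-rows : ∀ m → allVecs (suc m) ≡ cartesianProductWith _∷_ elements (allVecs m)
  allVecs-rows m = concatMap-rows _∷_ elements (allVecs m)

  allVecs-complete : ∀ {m} (v : Vector m) → v ∈ allVecs m
  allVecs-complete []           = here refl
  allVecs-complete {suc m} (x ∷ v) =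
    subst ((x ∷ v) ∈_) (sym (allVecs-rows m))
      (∈P.∈-cartesianProductWith⁺ _∷_ (complete x) (allVecs-complete v))

  allVecs-unique : ∀ m → Unique (allVecs m)
  allVecs-unique zero    = All.[] ∷ []
  allVecs-unique (suc m) =
    subst Unique (sym (allVecs-rows m))
      (UniqueP.cartesianProductWith⁺ _∷_ VecP.∷-injective unique (allVecs-unique m))

  -- `allPoints m` is `concatMap f (allVecs m)` for a helper f local to its definition, which lists
  -- the point of a vector if the vector is normalized; `pointsOf m` is that helper, obtained by
  -- unfolding the definition, so that it can be reasoned about.
  pointsOf : (m : ℕ) → Vector m → List (Point m)
  pointsOf m = proj₁ allPoints-as-concatMap
    where
    allPoints-as-concatMap : Σ (Vector m → List (Point m)) λ f → allPoints m ≡ concatMap f (allVecs m)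
    allPoints-as-concatMap = _ , refl

  pointsOf-normalized : ∀ {m} (v : Vector m) → Normalized v → ∃ λ nv → pointsOf m v ≡ (v , nv) ∷ []
  pointsOf-normalized v nv with normalized? v
  ... | yes nv' = nv' , refl
  ... | no ¬nv  = ⊥-elim (¬nv nv)

  pointsOf-vectors : ∀ {m} (v : Vector m) → List.map proj₁ (pointsOf m v) ≡ filter normalized? (v ∷ [])
  pointsOf-vectors v with normalized? v
  ... | yes _ = refl
  ... | no _  = refl

  allPoints-complete : ∀ {m} {p : Vector m} → Normalized p → ∃ λ np → (p , np) ∈ allPoints m
  allPoints-complete {m} {p} np =
    let (np' , pts≡) = pointsOf-normalized p np
    in np' , ∈P.∈-concatMap⁺ (pointsOf m) (lose (allVecs-complete p) (subst ((p , np') ∈_) (sym pts≡) (here refl)))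

  allPoints-unique : ∀ m → Unique (List.map proj₁ (allPoints m))
  allPoints-unique m =
    subst Unique (sym (vectors (allVecs m))) (UniqueP.filter⁺ normalized? (allVecs-unique m))
    where
    vectors : ∀ vs → List.map proj₁ (concatMap (pointsOf m) vs) ≡ filter normalized? vs
    vectors []       = refl
    vectors (v ∷ vs) = begin
      List.map proj₁ (pointsOf m v ++ concatMap (pointsOf m) vs)
        ≡⟨ ListP.map-++ proj₁ (pointsOf m v) _ ⟩
      List.map proj₁ (pointsOf m v) ++ List.map proj₁ (concatMap (pointsOf m) vs)
        ≡⟨ cong₂ _++_ (pointsOf-vectors v) (vectors vs) ⟩
      filter normalized? (v ∷ []) ++ filter normalized? vs
        ≡⟨ sym (ListP.filter-++ normalized? (v ∷ []) vs) ⟩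
      filter normalized? (v ∷ vs) ∎

  spanned-point : ∀ {m} (v : Vector m) → v ≢ zeroVec → ∃ λ (P : Point m) → P ∈ allPoints m × SpanEq v P
  spanned-point v v≢0 =
    let (p , np , α , α≢0 , v≡αp) = normalize v v≢0
        (np' , p∈) = allPoints-complete np
    in (p , np') , p∈ , α , α≢0 , v≡αp

module Multiplicities (F : FiniteField) where

  open import Algebra.Structures using (IsCommutativeRing)
  open import Data.Nat.Solver using (module +-*-Solver)
  open Counting
  open FF F
  open Projective F
  open IsCommutativeRing isCommutativeRing using (*-assoc; *-identityˡ; *-identityʳ; zeroʳ)

  column-nonzero : ∀ {m N} (M : Mat m N) → FullEffectiveLength M → ∀ j → column M j ≢ zeroVec
  column-nonzero M effective j col≡0 =
    let (c , cj≢0) = effective j in cj≢0 (trans (cong (dot c) col≡0) (dot-zeroʳ c))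

  zeros+weight : ∀ {N} (c : Fin N → Carrier) → count (λ j → c j ≟ 0#) (allFin N) ℕ.+ weight c ≡ N
  zeros+weight {N} c = trans (count-complement (λ j → c j ≟ 0#) (allFin N)) (ListP.length-tabulate id)

  hyperplane-points : ∀ {m} (H : Hyperplane m) (v : Vector m) → v ≢ zeroVec →
    count (spanEq? v) (filter (λ Q → Q ≤ₚ? H) (allPoints m)) ≡ indicator (dot (proj₁ H) v ≟ 0#)
  hyperplane-points {m} H@(h , _) v v≢0 =
    trans (count-filter (spanEq? v) (λ Q → Q ≤ₚ? H) (allPoints m)) (inH (dot h v ≟ 0#))
    where
    inH : (d : Dec (dot h v ≡ 0#)) → count (λ Q → spanEq? v Q ×-dec Q ≤ₚ? H) (allPoints m) ≡ indicator d
    inH (yes hv≡0) =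
      let (P@(p , _) , P∈ , α , α≢0 , v≡αp) = spanned-point v v≢0
          hp≡0 : dot h p ≡ 0#
          hp≡0 = *-zero-cancelˡ α≢0 (trans (sym (dot-scaleʳ h p α)) (trans (cong (dot h) (sym v≡αp)) hv≡0))
      in count-one _ proj₁ (allPoints m) (allPoints-unique m)
           (λ {Q} {Q'} (spanQ , _) (spanQ' , _) → spanEq-unique Q Q' spanQ spanQ') P∈ ((α , α≢0 , v≡αp) , hp≡0)
    inH (no hv≢0) = count-zero _ (allPoints m) (λ { (q , _) _ ((γ , _ , v≡γq) , hq≡0) → hv≢0 (begin
      dot h v             ≡⟨ cong (dot h) v≡γq ⟩
      dot h (scale γ q)   ≡⟨ dot-scaleʳ h q γ ⟩
      γ * dot h q         ≡⟨ cong (γ *_) hq≡0 ⟩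
      γ * 0#              ≡⟨ zeroʳ γ ⟩
      0#                  ∎) })
      where open ≡-Reasoning

  hyperplane-multiplicity : ∀ {m N} (M : Mat m N) → FullEffectiveLength M → (H : Hyperplane m) →
    sum (List.map (colCount M) (filter (λ Q → Q ≤ₚ? H) (allPoints m)))
      ≡ count (λ j → codeword M (proj₁ H) j ≟ 0#) (allFin N)
  hyperplane-multiplicity {m} {N} M effective H =
    double-count (λ Q j → spanEq? (column M j) Q) (λ j → codeword M (proj₁ H) j ≟ 0#)
      (filter (λ Q → Q ≤ₚ? H) (allPoints m)) (allFin N)
      (λ j → hyperplane-points H (column M j) (column-nonzero M effective j))

  hyperplane-equation : ∀ {m N} (M : Mat m N) → FullEffectiveLength M → (H : Hyperplane m) →
    ∀ Δ a i → a ≤ i → weight (codeword M (proj₁ H)) ≡ i ℕ.* Δ →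
    Δ ℕ.* (i ∸ a) ℕ.+ sum (List.map (colCount M) (filter (λ Q → Q ≤ₚ? H) (allPoints m))) ℕ.+ a ℕ.* Δ ≡ N
  hyperplane-equation {m} {N} M effective H Δ a i a≤i weight≡iΔ = begin
    Δ ℕ.* (i ∸ a) ℕ.+ S ℕ.+ a ℕ.* Δ   ≡⟨ cong (λ s → Δ ℕ.* (i ∸ a) ℕ.+ s ℕ.+ a ℕ.* Δ) (hyperplane-multiplicity M effective H) ⟩
    Δ ℕ.* (i ∸ a) ℕ.+ Z ℕ.+ a ℕ.* Δ   ≡⟨ regroup Δ (i ∸ a) Z a ⟩
    Z ℕ.+ ((i ∸ a) ℕ.+ a) ℕ.* Δ       ≡⟨ cong (λ t → Z ℕ.+ t ℕ.* Δ) (ℕP.m∸n+n≡m a≤i) ⟩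
    Z ℕ.+ i ℕ.* Δ                     ≡⟨ cong (Z ℕ.+_) (sym weight≡iΔ) ⟩
    Z ℕ.+ weight (codeword M (proj₁ H)) ≡⟨ zeros+weight (codeword M (proj₁ H)) ⟩
    N                                 ∎
    where
    open ≡-Reasoning
    open +-*-Solver
    S Z : ℕ
    S = sum (List.map (colCount M) (filter (λ Q → Q ≤ₚ? H) (allPoints m)))
    Z = count (λ j → codeword M (proj₁ H) j ≟ 0#) (allFin N)
    regroup : ∀ Δ d Z a → Δ ℕ.* d ℕ.+ Z ℕ.+ a ℕ.* Δ ≡ Z ℕ.+ (d ℕ.+ a) ℕ.* Δ
    regroup = solve 4 (λ Δ d Z a → Δ :* d :+ Z :+ a :* Δ := Z :+ (d :+ a) :* Δ) refl

  topRows : ∀ {m N} → Mat (suc m) N → Fin N → Vector m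
  topRows M j = tabulate (λ i → M (Fin.inject₁ i) j)

  column-split : ∀ {m N} (M : Mat (suc m) N) j → column M j ≡ topRows M j ∷ʳ M (Fin.fromℕ m) j
  column-split M j = tabulate-∷ʳ (λ i → M i j)
    where
    tabulate-∷ʳ : ∀ {m} (f : Fin (suc m) → Carrier) →
                  tabulate f ≡ tabulate (λ i → f (Fin.inject₁ i)) ∷ʳ f (Fin.fromℕ m)
    tabulate-∷ʳ {ℕ.zero} f = refl
    tabulate-∷ʳ {suc m}  f = cong (f Fin.zero ∷_) (tabulate-∷ʳ (λ i → f (Fin.suc i)))

  fiber-points : ∀ {m} (u : Point m) (t : Vector m) (l : Carrier) →
    count (λ α → spanEq? (t ∷ʳ l) (ext u α)) elements ≡ indicator (spanEq? t u)
  fiber-points (u , nu) t l = fiber (spanEq? t (u , nu))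
    where
    open ≡-Reasoning
    scale-∷ʳ : ∀ γ α → scale γ (u ∷ʳ α) ≡ scale γ u ∷ʳ (γ * α)
    scale-∷ʳ γ α = VecP.map-∷ʳ (γ *_) α u
    fiber : (d : Dec (SpanEq t (u , nu))) → count (λ α → spanEq? (t ∷ʳ l) (ext (u , nu) α)) elements ≡ indicator d
    fiber (yes (β , β≢0 , t≡βu)) = count-one _ id elements (subst Unique (sym (ListP.map-id elements)) unique)
        sameLast (complete (β≢0 ⁻¹ * l)) (β , β≢0 , spans)
      where
      β[β⁻¹l]≡l : β * (β≢0 ⁻¹ * l) ≡ l
      β[β⁻¹l]≡l = trans (sym (*-assoc β _ l)) (trans (cong (_* l) (inverseʳ β≢0)) (*-identityˡ l))
      spans : t ∷ʳ l ≡ scale β (u ∷ʳ (β≢0 ⁻¹ * l))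
      spans = begin
        t ∷ʳ l                        ≡⟨ cong₂ _∷ʳ_ t≡βu (sym β[β⁻¹l]≡l) ⟩
        scale β u ∷ʳ (β * (β≢0 ⁻¹ * l)) ≡⟨ sym (scale-∷ʳ β _) ⟩
        scale β (u ∷ʳ (β≢0 ⁻¹ * l))   ∎
      -- the scalar is fixed by the first m entries, and then α by the last one
      sameLast : ∀ {α α'} → SpanEq (t ∷ʳ l) (ext (u , nu) α) → SpanEq (t ∷ʳ l) (ext (u , nu) α') → α ≡ α'
      sameLast {α} {α'} (γ , γ≢0 , eγ) (δ , _ , eδ) =
        let (γu≡δu , γα≡δα') = VecP.∷ʳ-injective (scale γ u) (scale δ u)
                                  (trans (sym (scale-∷ʳ γ α)) (trans (trans (sym eγ) eδ) (scale-∷ʳ δ α')))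
        in *-cancelˡ γ≢0 (trans γα≡δα' (cong (_* α') (sym (normalized-scalar nu γu≡δu))))
    fiber (no ¬span) = count-zero _ elements (λ α _ (γ , γ≢0 , e) →
      ¬span (γ , γ≢0 , VecP.∷ʳ-injectiveˡ t (scale γ u) (trans e (scale-∷ʳ γ α))))

  fiber-multiplicity : ∀ {m N} (M : Mat (suc m) N) (u : Point m) →
    sum (List.map (λ α → colCount M (ext u α)) elements) ≡ count (λ j → spanEq? (topRows M j) u) (allFin N)
  fiber-multiplicity {N = N} M u =
    double-count (λ α j → spanEq? (column M j) (ext u α)) (λ j → spanEq? (topRows M j) u) elements (allFin N)
      (λ j → subst (λ v → count (λ α → spanEq? v (ext u α)) elements ≡ indicator (spanEq? (topRows M j) u))
                   (sym (column-split M j)) (fiber-points u (topRows M j) (M (Fin.fromℕ _) j)))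

  unit-last : ∀ m → unit {suc m} (Fin.fromℕ m) ≡ zeroVec {m} ∷ʳ 1#
  unit-last ℕ.zero    = refl
  unit-last (suc m) = cong (0# ∷_) (unit-last m)

  spans-lastUnit⇒ : ∀ {m} (t : Vector m) l → SpanEq (t ∷ʳ l) (unitPoint (Fin.fromℕ m)) → t ≡ zeroVec
  spans-lastUnit⇒ {m} t l (γ , _ , e) =
    trans (VecP.∷ʳ-injectiveˡ t (scale γ zeroVec)
            (trans e (trans (cong (scale γ) (unit-last m)) (VecP.map-∷ʳ (γ *_) 1# zeroVec))))
          (scale-zeroVec γ)

  spans-lastUnit⇐ : ∀ {m} l → zeroVec {m} ∷ʳ l ≢ zeroVec → SpanEq (zeroVec ∷ʳ l) (unitPoint (Fin.fromℕ m))
  spans-lastUnit⇐ {m} l nonzero = l , l≢0 , (begin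
    zeroVec ∷ʳ l                      ≡⟨ cong₂ _∷ʳ_ (sym (scale-zeroVec l)) (sym (*-identityʳ l)) ⟩
    scale l zeroVec ∷ʳ (l * 1#)       ≡⟨ sym (VecP.map-∷ʳ (l *_) 1# zeroVec) ⟩
    scale l (zeroVec ∷ʳ 1#)           ≡⟨ cong (scale l) (sym (unit-last m)) ⟩
    scale l (unit (Fin.fromℕ m))      ∎)
    where
    open ≡-Reasoning
    zero-∷ʳ : ∀ m → zeroVec {m} ∷ʳ 0# ≡ zeroVec {suc m}
    zero-∷ʳ ℕ.zero    = refl
    zero-∷ʳ (suc m) = cong (0# ∷_) (zero-∷ʳ m)
    l≢0 : l ≢ 0#
    l≢0 l≡0 = nonzero (trans (cong (zeroVec ∷ʳ_) l≡0) (zero-∷ʳ m))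

  unit-symmetric : ∀ {m} (i j : Fin m) → Vec.lookup (unit i) j ≡ Vec.lookup (unit j) i
  unit-symmetric Fin.zero    Fin.zero    = refl
  unit-symmetric Fin.zero    (Fin.suc j) = VecP.lookup-replicate j 0#
  unit-symmetric (Fin.suc i) Fin.zero    = sym (VecP.lookup-replicate i 0#)
  unit-symmetric (Fin.suc i) (Fin.suc j) = unit-symmetric i j

  systematic-column : ∀ {m N} (M : Mat m N) (systematic : IsSystematic M) →
                      ∀ i → column M (inject≤ i (proj₁ systematic)) ≡ unit i
  systematic-column M (_ , identity) i = begin
    tabulate (λ i' → M i' (inject≤ i _))        ≡⟨ VecP.tabulate-cong (λ i' → trans (identity i' i) (unit-symmetric i' i)) ⟩
    tabulate (Vec.lookup (unit i))              ≡⟨ VecP.tabulate∘lookup (unit i) ⟩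
    unit i                                      ∎
    where open ≡-Reasoning

  unit-multiplicity : ∀ {m N} (M : Mat m N) → IsSystematic M → ∀ i → 1 ≤ colCount M (unitPoint i)
  unit-multiplicity {N = N} M systematic i =
    count-pos (λ j → spanEq? (column M j) (unitPoint i)) (allFin N) (∈P.∈-allFin (inject≤ i (proj₁ systematic)))
      (1# , 1≢0 , trans (systematic-column M systematic i) (sym (scale-one (unit i))))

  systematic-codeword-nonzero : ∀ {m N} (M : Mat m N) → IsSystematic M →
                                ∀ {h : Vector m} → Normalized h → ¬ IsZeroWord (codeword M h)
  systematic-codeword-nonzero M systematic {h} nh hM≡0 =
    let (i , hᵢ≡1) = leading-one nh in
    1≢0 (begin
      1#                                                 ≡⟨ sym hᵢ≡1 ⟩
      Vec.lookup h i                                     ≡⟨ sym (dot-unitʳ h i) ⟩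
      dot h (unit i)                                     ≡⟨ cong (dot h) (sym (systematic-column M systematic i)) ⟩
      codeword M h (inject≤ i (proj₁ systematic))        ≡⟨ hM≡0 _ ⟩
      0#                                                 ∎)
    where
    open ≡-Reasoning
    leading-one : ∀ {m} {h : Vector m} → Normalized h → ∃ λ i → Vec.lookup h i ≡ 1#
    leading-one here       = Fin.zero , refl
    leading-one (there nh) = let (i , hᵢ≡1) = leading-one nh in Fin.suc i , hᵢ≡1

module ZeroColumnExtension (F : FiniteField) {k n r : ℕ} (G : FF.Mat F k n) (G' : FF.Mat F (suc k) (n ℕ.+ r))
                           (extends : FF.ExtendsWithZeroCols F r G' G) where

  open Counting
  open FF F
  open Projective F
  open Multiplicities F

  N : ℕ
  N = n ℕ.+ r

  ι : Fin n → Fin N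
  ι = proj₁ extends

  ι-injective : ∀ {j j'} → ι j ≡ ι j' → j ≡ j'
  ι-injective = strictlyMonotone⇒injective ι (proj₁ (proj₂ extends))

  InImage : Fin N → Set
  InImage j' = ∃ λ j → ι j ≡ j'

  image? : ∀ j' → Dec (InImage j')
  image? j' = FinP.any? (λ j → ι j Fin.≟ j')

  top-image : ∀ j → topRows G' (ι j) ≡ column G j
  top-image j = VecP.tabulate-cong (λ i → proj₁ (proj₂ (proj₂ extends)) i j)

  top-outside : ∀ j' → ¬ InImage j' → topRows G' j' ≡ zeroVec
  top-outside j' outside =
    trans (VecP.tabulate-cong (proj₂ (proj₂ (proj₂ extends)) j' (λ j ιj≡j' → outside (j , ιj≡j'))))
          (tabulate-const 0#)
    where
    tabulate-const : ∀ {m} (c : Carrier) → Vec.tabulate {n = m} (λ _ → c) ≡ Vec.replicate m c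
    tabulate-const {ℕ.zero} c = refl
    tabulate-const {suc m}  c = cong (c ∷_) (tabulate-const c)

  -- The columns of G' whose first k entries span ⟨u⟩ correspond to the columns of G spanning ⟨u⟩,
  -- since the inserted columns have zero top part.
  top-multiplicity : ∀ (u : Point k) → count (λ j' → spanEq? (topRows G' j') u) (allFin N) ≡ colCount G u
  top-multiplicity u@(_ , nu) = trans
    (count-along-injection ι ι-injective (λ j' → spanEq? (topRows G' j') u) onImage)
    (count-cong _ _ (λ j span → subst (λ v → SpanEq v u) (top-image j) span)
                    (λ j span → subst (λ v → SpanEq v u) (sym (top-image j)) span) (allFin n))
    where
    onImage : ∀ j' → SpanEq (topRows G' j') u → InImage j'
    onImage j' (α , α≢0 , top≡αu) = decidable-stable (image? j') (λ outside →
      normalized-nonzero nu α≢0 (trans (sym top≡αu) (top-outside j' outside)))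

  lastUnit-multiplicity : FullEffectiveLength G → FullEffectiveLength G' → colCount G' (unitPoint (Fin.fromℕ k)) ≡ r
  lastUnit-multiplicity effective effective' = ℕP.+-cancelˡ-≡ n _ _ (begin
    n ℕ.+ colCount G' e                                  ≡⟨ cong (ℕ._+ colCount G' e) (sym images) ⟩
    count image? (allFin N) ℕ.+ colCount G' e            ≡⟨ cong (count image? (allFin N) ℕ.+_)
                                                               (count-cong _ _ outside⇐spans spans⇐outside (allFin N)) ⟩
    count image? (allFin N) ℕ.+ count (λ j' → ¬? (image? j')) (allFin N) ≡⟨ count-complement image? (allFin N) ⟩
    List.length (allFin N)                          ≡⟨ ListP.length-tabulate id ⟩
    N                                                    ∎)
    where
    open ≡-Reasoning
    e : Point (suc k)
    e = unitPoint (Fin.fromℕ k)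
    images : count image? (allFin N) ≡ n
    images = trans (count-along-injection ι ι-injective image? (λ _ inImage → inImage))
                   (trans (count-all _ (allFin n) (λ j → j , refl)) (ListP.length-tabulate id))
    outside⇐spans : ∀ j' → SpanEq (column G' j') e → ¬ InImage j'
    outside⇐spans j' span (j , refl) =
      column-nonzero G effective j (trans (sym (top-image j))
        (spans-lastUnit⇒ (topRows G' (ι j)) _ (subst (λ v → SpanEq v e) (column-split G' (ι j)) span)))
    spans⇐outside : ∀ j' → ¬ InImage j' → SpanEq (column G' j') e
    spans⇐outside j' outside =
      let column≡ : column G' j' ≡ zeroVec ∷ʳ G' (Fin.fromℕ k) j'
          column≡ = trans (column-split G' j') (cong (_∷ʳ G' (Fin.fromℕ k) j') (top-outside j' outside))
      in subst (λ v → SpanEq v e) (sym column≡)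
           (spans-lastUnit⇐ _ (λ col≡0 → column-nonzero G' effective' j' (trans column≡ col≡0)))

lemma2p1 : (F : FiniteField) → let open FF F in
    ∀ {k n : ℕ} (Δ a b r : ℕ) → 1 ≤ Δ → 1 ≤ a → a ≤ b → 1 ≤ r →
    (G : Mat k n) → IsSystematic G → FullEffectiveLength G → WeightsIn G Δ a b →
    (G' : Mat (suc k) (n ℕ.+ r)) → IsSystematic G' → FullEffectiveLength G' →
    ExtendsWithZeroCols r G' G → WeightsIn G' Δ a b →
    ∃ λ (x : Point (suc k) → ℕ) → ∃ λ (y : Hyperplane (suc k) → ℕ) →
    InS G Δ a b r x y × (∀ (Q : Point (suc k)) → colCount G' Q ≡ x Q)
lemma2p1 F {k} {n} Δ a b r _ _ _ _ G _ effective _ G' systematic' effective' extends weights' =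
  colCount G' , y , (equation , fibers , lastUnit , units , y≤b-a) , λ _ → refl
  where
  open FF F
  open Multiplicities F
  open ZeroColumnExtension F G G' extends

  level : (H : Hyperplane (suc k)) → ∃ λ i → a ≤ i × i ≤ b × weight (codeword G' (proj₁ H)) ≡ i ℕ.* Δ
  level (h , nh) = weights' h (systematic-codeword-nonzero G' systematic' nh)

  y : Hyperplane (suc k) → ℕ
  y H = proj₁ (level H) ℕ.∸ a

  equation : ∀ H → Δ ℕ.* y H ℕ.+ sum (List.map (colCount G') (filter (λ Q → Q ≤ₚ? H) (allPoints (suc k))))
                      ℕ.+ a ℕ.* Δ ≡ n ℕ.+ r
  equation H = let (i , a≤i , _ , weight≡iΔ) = level H in hyperplane-equation G' effective' H Δ a i a≤i weight≡iΔ

  fibers : ∀ u → sum (List.map (λ α → colCount G' (ext u α)) elements) ≡ colCount G u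
  fibers u = trans (fiber-multiplicity G' u) (top-multiplicity u)

  lastUnit : colCount G' (unitPoint (Fin.fromℕ k)) ≡ r
  lastUnit = lastUnit-multiplicity effective effective'

  units : ∀ i → 1 ≤ colCount G' (unitPoint i)
  units = unit-multiplicity G' systematic'

  y≤b-a : ∀ H → y H ≤ b ℕ.∸ a
  y≤b-a H = ℕP.∸-monoˡ-≤ a (proj₁ (proj₂ (proj₂ (level H))))
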